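{- Let $t$ and $s$ be terms of the call-by-value $\lambda$-calculus with callcc and abort that contain no context variables. If $t\mathrel{\approx^t}s$, i.e. $(k\,t)\approx(k\,s)$ for a fresh context variable $k$, then $t$ and $s$ are contextually equivalent: for every context $C$ (a term of this calculus without context variables, with one hole) such that $C[t]$ and $C[s]$ have no free variables, the reduction of the program $C[t]$ terminates if and only if the reduction of the program $C[s]$ terminates.
   Context: Syntax of the original calculus: terms $t,s::=x\mid\lambda x.t\mid t\,s\mid\mathcal C\mid\mathcal A\,p$ with programs $p::=t$; values $v,w::=x\mid\lambda x.t\mid\mathcal C$ ($\mathcal C$ is callcc, $\mathcal A$ is abort); contexts $C$ are such terms with one hole, possibly under binders or under $\mathcal A$. Extended syntax with context variables $k$: programs $p,q::=t\mid k\,t$; evaluation contexts $E::=[\,]\mid v\,E\mid E\,t$; program contexts $F::=E\mid k\,E$; $F[t]$ is plugging. Terms modulo $\alpha$-conversion, capture-avoiding substitution $p\{v/x\}$. Reduction on programs: $F[(\lambda x.t)\,v]\to F[t\{v/x\}]$; $F[\mathcal C\,v]\to F[v\,(\lambda y.\mathcal A\,F[y])]$ with $y$ not free in $F$; $F[\mathcal A\,p]\to p$. $\to^*$ reflexive-transitive closure; $p\Downarrow q$ iff $p\to^*q$ with $q$ irreducible. Fresh means not occurring in the objects under consideration. For a relation $R$ on programs: $t\mathrel{R^t}s$ iff $(k\,t)\mathrel R(k\,s)$ for fresh $k$; $v\mathrel{R^v}w$ iff $(v\,x)\mathrel{R^t}(w\,x)$ for fresh $x$; $F\mathrel{R^E}F'$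 iff $F[x]\mathrel RF'[x]$ for fresh $x$; $F[x\,v]\mathrel{R^o}F'[x\,w]$ iff $F\mathrel{R^E}F'$ and $v\mathrel{R^v}w$. $R$ is a normal-form bisimulation if whenever $p\mathrel Rq$: (i) if $p\to p'$ then $q\to^*q'$ with $p'\mathrel Rq'$; (ii) if $p$ is a value then $q\Downarrow w$ for some value $w$; (iii) if $p=F[x\,v]$ then $q\Downarrow F'[x\,w]$ with $F[x\,v]\mathrel{R^o}F'[x\,w]$; (iv) if $p=k\,v$ then $q\Downarrow k\,w$ with $v\mathrel{R^v}w$; (v) the symmetric conditions with $p,q$ exchanged. Normal-form bisimilarity $\approx$ is the union of all normal-form bisimulations. -}

module Defs where

open import Level using (Level; 0ℓ; _⊔_) renaming (suc to lsuc)
open import Data.Nat using (ℕ; zero; suc)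
open import Data.Fin using (Fin; zero; suc)
open import Data.Product using (Σ; ∃; ∃-syntax; _×_; _,_)
open import Relation.Nullary using (¬_)
open import Relation.Binary.PropositionalEquality using (_≡_)
open import Relation.Binary.Construct.Closure.ReflexiveTransitive using (Star)

-- Syntax (well-scoped de Bruijn representation, terms modulo α).
-- Term m n / Prog m n : at most m context variables (k) and
-- n term variables (x) free.

mutual
  data Term (m n : ℕ) : Set where
    var   : Fin n → Term m n
    lam   : Term m (suc n) → Term m n
    app   : Term m n → Term m n → Term m n
    callcc : Term m n
    abort : Prog m n → Term m n

  data Prog (m n : ℕ) : Set where
    term : Term m n → Prog m n
    capp : Fin m → Term m n → Prog m n

data Val (m n : ℕ) : Set where
  vvar : Fin n → Val m n
  vlam : Term m (suc n) → Val m n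
  vcc  : Val m n

⌜_⌝ : ∀ {m n} → Val m n → Term m n
⌜ vvar x ⌝ = var x
⌜ vlam t ⌝ = lam t
⌜ vcc ⌝    = callcc

data ECtx (m n : ℕ) : Set where
  hole : ECtx m n
  appR : Val m n → ECtx m n → ECtx m n
  appL : ECtx m n → Term m n → ECtx m n

data PCtx (m n : ℕ) : Set where
  ectx : ECtx m n → PCtx m n
  kctx : Fin m → ECtx m n → PCtx m n

plugE : ∀ {m n} → ECtx m n → Term m n → Term m n
plugE hole       t = t
plugE (appR v E) t = app ⌜ v ⌝ (plugE E t)
plugE (appL E s) t = app (plugE E t) s

plugP : ∀ {m n} → PCtx m n → Term m n → Prog m n
plugP (ectx E)   t = term (plugE E t)
plugP (kctx k E) t = capp k (plugE E t)

ext : ∀ {n n'} → (Fin n → Fin n') → Fin (suc n) → Fin (suc n')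
ext ρ zero    = zero
ext ρ (suc i) = suc (ρ i)

mutual
  renT : ∀ {m m' n n'} → (Fin m → Fin m') → (Fin n → Fin n') → Term m n → Term m' n'
  renT κ ρ (var x)   = var (ρ x)
  renT κ ρ (lam t)   = lam (renT κ (ext ρ) t)
  renT κ ρ (app t s) = app (renT κ ρ t) (renT κ ρ s)
  renT κ ρ callcc    = callcc
  renT κ ρ (abort p) = abort (renP κ ρ p)

  renP : ∀ {m m' n n'} → (Fin m → Fin m') → (Fin n → Fin n') → Prog m n → Prog m' n'
  renP κ ρ (term t)   = term (renT κ ρ t)
  renP κ ρ (capp k t) = capp (κ k) (renT κ ρ t)

renV : ∀ {m m' n n'} → (Fin m → Fin m') → (Fin n → Fin n') → Val m n → Val m' n'
renV κ ρ (vvar x) = vvar (ρ x)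
renV κ ρ (vlam t) = vlam (renT κ (ext ρ) t)
renV κ ρ vcc      = vcc

renE : ∀ {m m' n n'} → (Fin m → Fin m') → (Fin n → Fin n') → ECtx m n → ECtx m' n'
renE κ ρ hole       = hole
renE κ ρ (appR v E) = appR (renV κ ρ v) (renE κ ρ E)
renE κ ρ (appL E t) = appL (renE κ ρ E) (renT κ ρ t)

renF : ∀ {m m' n n'} → (Fin m → Fin m') → (Fin n → Fin n') → PCtx m n → PCtx m' n'
renF κ ρ (ectx E)   = ectx (renE κ ρ E)
renF κ ρ (kctx k E) = kctx (κ k) (renE κ ρ E)

idF : ∀ {n} → Fin n → Fin n
idF i = i

wkT : ∀ {m n} → Term m n → Term m (suc n)
wkT = renT idF suc

wkV : ∀ {m n} → Val m n → Val m (suc n)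
wkV = renV idF suc

wkF : ∀ {m n} → PCtx m n → PCtx m (suc n)
wkF = renF idF suc

wkKT : ∀ {m n} → Term m n → Term (suc m) n
wkKT = renT suc idF

exts : ∀ {m n n'} → (Fin n → Term m n') → Fin (suc n) → Term m (suc n')
exts σ zero    = var zero
exts σ (suc i) = wkT (σ i)

mutual
  subT : ∀ {m n n'} → (Fin n → Term m n') → Term m n → Term m n'
  subT σ (var x)   = σ x
  subT σ (lam t)   = lam (subT (exts σ) t)
  subT σ (app t s) = app (subT σ t) (subT σ s)
  subT σ callcc    = callcc
  subT σ (abort p) = abort (subP σ p)

  subP : ∀ {m n n'} → (Fin n → Term m n') → Prog m n → Prog m n'
  subP σ (term t)   = term (subT σ t)
  subP σ (capp k t) = capp k (subT σ t)

single : ∀ {m n} → Val m n → Fin (suc n) → Term m n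
single v zero    = ⌜ v ⌝
single v (suc i) = var i

_[_] : ∀ {m n} → Term m (suc n) → Val m n → Term m n
t [ v ] = subT (single v) t

infix 4 _⟶_ _⟶*_ _⇓_

data _⟶_ {m n : ℕ} : Prog m n → Prog m n → Set where
  β      : (F : PCtx m n) (t : Term m (suc n)) (v : Val m n) →
           plugP F (app (lam t) ⌜ v ⌝) ⟶ plugP F (t [ v ])
  ccRed  : (F : PCtx m n) (v : Val m n) →
           -- F[𝒞 v] → F[v (λy. 𝒜 F[y])], y fresh (bound index zero)
           plugP F (app callcc ⌜ v ⌝) ⟶
           plugP F (app ⌜ v ⌝ (lam (abort (plugP (wkF F) (var zero)))))
  abRed  : (F : PCtx m n) (p : Prog m n) →
           plugP F (abort p) ⟶ p

_⟶*_ : ∀ {m n} → Prog m n → Prog m n → Set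
_⟶*_ = Star _⟶_

Irreducible : ∀ {m n} → Prog m n → Set
Irreducible p = ¬ (∃[ p' ] (p ⟶ p'))

_⇓_ : ∀ {m n} → Prog m n → Prog m n → Set
p ⇓ q = (p ⟶* q) × Irreducible q

PRel : (ℓ : Level) → Set (lsuc ℓ)
PRel ℓ = ∀ {m n} → Prog m n → Prog m n → Set ℓ

flipR : ∀ {ℓ} → PRel ℓ → PRel ℓ
flipR R p q = R q p

_^t : ∀ {ℓ} → PRel ℓ → ∀ {m n} → Term m n → Term m n → Set ℓ
(R ^t) t s = R (capp zero (wkKT t)) (capp zero (wkKT s))

_^v : ∀ {ℓ} → PRel ℓ → ∀ {m n} → Val m n → Val m n → Set ℓ
(R ^v) v w = (R ^t) (app ⌜ wkV v ⌝ (var zero)) (app ⌜ wkV w ⌝ (var zero))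

_^E : ∀ {ℓ} → PRel ℓ → ∀ {m n} → PCtx m n → PCtx m n → Set ℓ
(R ^E) F F' = R (plugP (wkF F) (var zero)) (plugP (wkF F') (var zero))

record Progress (R : PRel 0ℓ) : Set where
  field
    red   : ∀ {m n} {p q : Prog m n} → R p q → ∀ {p'} → p ⟶ p' →
            ∃[ q' ] ((q ⟶* q') × R p' q')
    value : ∀ {m n} {p q : Prog m n} → R p q → (v : Val m n) →
            p ≡ term ⌜ v ⌝ → ∃[ w ] (q ⇓ term ⌜ w ⌝)
    open-stuck : ∀ {m n} {p q : Prog m n} → R p q →
            (F : PCtx m n) (x : Fin n) (v : Val m n) →
            p ≡ plugP F (app (var x) ⌜ v ⌝) →
            ∃[ F' ] ∃[ w ] ((q ⇓ plugP F' (app (var x) ⌜ w ⌝))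
                            × (R ^E) F F' × (R ^v) v w)
    kvalue : ∀ {m n} {p q : Prog m n} → R p q → (k : Fin m) (v : Val m n) →
            p ≡ capp k ⌜ v ⌝ → ∃[ w ] ((q ⇓ capp k ⌜ w ⌝) × (R ^v) v w)

IsNFBisim : PRel 0ℓ → Set
IsNFBisim R = Progress R × Progress (flipR R)

_≈_ : PRel (lsuc 0ℓ)
p ≈ q = Σ (PRel 0ℓ) (λ R → IsNFBisim R × R p q)

-- Ctx n h : a context whose
-- plugging yields a term with n free variables, hole in scope h.

data Ctx (n : ℕ) : ℕ → Set where
  ● : Ctx n n
  lamC  : ∀ {h} → Ctx (suc n) h → Ctx n h
  appLC : ∀ {h} → Ctx n h → Term 0 n → Ctx n h
  appRC : ∀ {h} → Term 0 n → Ctx n h → Ctx n h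
  abortC : ∀ {h} → Ctx n h → Ctx n h

plugC : ∀ {n h} → Ctx n h → Term 0 h → Term 0 n
plugC ●            t = t
plugC (lamC C)     t = lam (plugC C t)
plugC (appLC C s)  t = app (plugC C t) s
plugC (appRC s C)  t = app s (plugC C t)
plugC (abortC C)   t = abort (term (plugC C t))

Terminates : ∀ {m n} → Prog m n → Set
Terminates p = ∃[ q ] (p ⇓ q)

-- Let ∼ be the least relation containing every instance Θ(p) ∼ Θ'(q) of p ≈ q, where Θ
-- and Θ' send context variables to ∼-related program contexts and term variables to
-- ∼-related values, and closed under the constructs of the calculus. On closed programs
-- ∼ is a simulation up to reduction: if P ∼ Q then either P is a value and Q reduces to a
-- value, or P ⟶ P' and Q ⟶* Q' with P' ∼ Q'. For instances of ≈ this is what the clauses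
-- of a normal-form bisimulation give once the substitution is applied: a matched reduction
-- remains a reduction, and a matched stuck program F[x v] or returned value k v becomes an
-- application of related values or a return of related values into related contexts.
-- Reduction being deterministic, termination of P then transfers to Q. Finally t ≈ᵗ s
-- yields t ∼ s under the identity substitution, and compatibility yields C[t] ∼ C[s].

module Submission where

open import Defs
open import Data.Nat using (ℕ; zero; suc)
open import Data.Fin using (Fin; zero; suc)
open import Data.Product using (∃-syntax; _×_; _,_; proj₁; proj₂)
open import Data.Empty using (⊥; ⊥-elim)
open import Data.Unit using (⊤; tt)
open import Data.Vec.Functional using (_∷_)
open import Function using (_∘_)
open import Relation.Nullary using (¬_)
open import Relation.Binary.PropositionalEquality hiding ([_])
open import Relation.Binary.Construct.Closure.ReflexiveTransitive using (ε; _◅_; _◅◅_; gmap)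

open ≡-Reasoning

private variable
  m m' m0 m1 m2 m3 n n' n0 n1 n2 n3 h : ℕ

compE : ECtx m n → ECtx m n → ECtx m n
compE hole E2 = E2
compE (appR v E) E2 = appR v (compE E E2)
compE (appL E t) E2 = appL (compE E E2) t

compP : PCtx m n → ECtx m n → PCtx m n
compP (ectx E) E2 = ectx (compE E E2)
compP (kctx k E) E2 = kctx k (compE E E2)

plugE-compE : ∀ (E E2 : ECtx m n) t → plugE (compE E E2) t ≡ plugE E (plugE E2 t)
plugE-compE hole E2 t = refl
plugE-compE (appR v E) E2 t = cong (app ⌜ v ⌝) (plugE-compE E E2 t)
plugE-compE (appL E s) E2 t = cong (λ z → app z s) (plugE-compE E E2 t)

plugP-compP : ∀ (F : PCtx m n) E2 t → plugP (compP F E2) t ≡ plugP F (plugE E2 t)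
plugP-compP (ectx E) E2 t = cong term (plugE-compE E E2 t)
plugP-compP (kctx k E) E2 t = cong (capp k) (plugE-compE E E2 t)

compE-assoc : (E1 E2 E3 : ECtx m n) → compE (compE E1 E2) E3 ≡ compE E1 (compE E2 E3)
compE-assoc hole E2 E3 = refl
compE-assoc (appR v E) E2 E3 = cong (appR v) (compE-assoc E E2 E3)
compE-assoc (appL E t) E2 E3 = cong (λ z → appL z t) (compE-assoc E E2 E3)

compP-assoc : (F : PCtx m n) (E2 E3 : ECtx m n) → compP (compP F E2) E3 ≡ compP F (compE E2 E3)
compP-assoc (ectx E) E2 E3 = cong ectx (compE-assoc E E2 E3)
compP-assoc (kctx k E) E2 E3 = cong (kctx k) (compE-assoc E E2 E3)

compE-identityʳ : (E : ECtx m n) → compE E hole ≡ E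
compE-identityʳ hole = refl
compE-identityʳ (appR v E) = cong (appR v) (compE-identityʳ E)
compE-identityʳ (appL E t) = cong (λ z → appL z t) (compE-identityʳ E)

compP-identityʳ : (F : PCtx m n) → compP F hole ≡ F
compP-identityʳ (ectx E) = cong ectx (compE-identityʳ E)
compP-identityʳ (kctx k E) = cong (kctx k) (compE-identityʳ E)

renT-⌜⌝ : ∀ (κ : Fin m → Fin m') (ρ : Fin n → Fin n') v → renT κ ρ ⌜ v ⌝ ≡ ⌜ renV κ ρ v ⌝
renT-⌜⌝ κ ρ (vvar x) = refl
renT-⌜⌝ κ ρ (vlam t) = refl
renT-⌜⌝ κ ρ vcc = refl

ext-cong : {ρ1 ρ2 : Fin n → Fin n'} → ρ1 ≗ ρ2 → ext ρ1 ≗ ext ρ2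
ext-cong e zero = refl
ext-cong e (suc i) = cong suc (e i)

mutual
  renT-cong : {κ1 κ2 : Fin m → Fin m'} {ρ1 ρ2 : Fin n → Fin n'} → κ1 ≗ κ2 → ρ1 ≗ ρ2 → ∀ t →
    renT κ1 ρ1 t ≡ renT κ2 ρ2 t
  renT-cong eκ eρ (var x) = cong var (eρ x)
  renT-cong eκ eρ (lam t) = cong lam (renT-cong eκ (ext-cong eρ) t)
  renT-cong eκ eρ (app t s) = cong₂ app (renT-cong eκ eρ t) (renT-cong eκ eρ s)
  renT-cong eκ eρ callcc = refl
  renT-cong eκ eρ (abort p) = cong abort (renP-cong eκ eρ p)

  renP-cong : {κ1 κ2 : Fin m → Fin m'} {ρ1 ρ2 : Fin n → Fin n'} → κ1 ≗ κ2 → ρ1 ≗ ρ2 → ∀ p →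
    renP κ1 ρ1 p ≡ renP κ2 ρ2 p
  renP-cong eκ eρ (term t) = cong term (renT-cong eκ eρ t)
  renP-cong eκ eρ (capp k t) = cong₂ capp (eκ k) (renT-cong eκ eρ t)

renV-cong : {κ1 κ2 : Fin m → Fin m'} {ρ1 ρ2 : Fin n → Fin n'} → κ1 ≗ κ2 → ρ1 ≗ ρ2 → ∀ v → renV κ1 ρ1 v ≡ renV κ2 ρ2 v
renV-cong eκ eρ (vvar x) = cong vvar (eρ x)
renV-cong eκ eρ (vlam t) = cong vlam (renT-cong eκ (ext-cong eρ) t)
renV-cong eκ eρ vcc = refl

renE-cong : {κ1 κ2 : Fin m → Fin m'} {ρ1 ρ2 : Fin n → Fin n'} → κ1 ≗ κ2 → ρ1 ≗ ρ2 → ∀ E → renE κ1 ρ1 E ≡ renE κ2 ρ2 E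
renE-cong eκ eρ hole = refl
renE-cong eκ eρ (appR v E) = cong₂ appR (renV-cong eκ eρ v) (renE-cong eκ eρ E)
renE-cong eκ eρ (appL E t) = cong₂ appL (renE-cong eκ eρ E) (renT-cong eκ eρ t)

renF-cong : {κ1 κ2 : Fin m → Fin m'} {ρ1 ρ2 : Fin n → Fin n'} → κ1 ≗ κ2 → ρ1 ≗ ρ2 → ∀ F → renF κ1 ρ1 F ≡ renF κ2 ρ2 F
renF-cong eκ eρ (ectx E) = cong ectx (renE-cong eκ eρ E)
renF-cong eκ eρ (kctx k E) = cong₂ kctx (eκ k) (renE-cong eκ eρ E)

ext-∘ : ∀ {a b c} (ρ1 : Fin b → Fin c) (ρ2 : Fin a → Fin b) → ext ρ1 ∘ ext ρ2 ≗ ext (ρ1 ∘ ρ2)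
ext-∘ ρ1 ρ2 zero = refl
ext-∘ ρ1 ρ2 (suc i) = refl

mutual
  renT-renT : ∀ (κ1 : Fin m2 → Fin m3) (ρ1 : Fin n2 → Fin n3) (κ2 : Fin m1 → Fin m2) (ρ2 : Fin n1 → Fin n2) t →
    renT κ1 ρ1 (renT κ2 ρ2 t) ≡ renT (κ1 ∘ κ2) (ρ1 ∘ ρ2) t
  renT-renT κ1 ρ1 κ2 ρ2 (var x) = refl
  renT-renT κ1 ρ1 κ2 ρ2 (lam t) =
    cong lam (trans (renT-renT κ1 (ext ρ1) κ2 (ext ρ2) t) (renT-cong (λ _ → refl) (ext-∘ ρ1 ρ2) t))
  renT-renT κ1 ρ1 κ2 ρ2 (app t s) = cong₂ app (renT-renT κ1 ρ1 κ2 ρ2 t) (renT-renT κ1 ρ1 κ2 ρ2 s)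
  renT-renT κ1 ρ1 κ2 ρ2 callcc = refl
  renT-renT κ1 ρ1 κ2 ρ2 (abort p) = cong abort (renP-renP κ1 ρ1 κ2 ρ2 p)

  renP-renP : ∀ (κ1 : Fin m2 → Fin m3) (ρ1 : Fin n2 → Fin n3) (κ2 : Fin m1 → Fin m2) (ρ2 : Fin n1 → Fin n2) p →
    renP κ1 ρ1 (renP κ2 ρ2 p) ≡ renP (κ1 ∘ κ2) (ρ1 ∘ ρ2) p
  renP-renP κ1 ρ1 κ2 ρ2 (term t) = cong term (renT-renT κ1 ρ1 κ2 ρ2 t)
  renP-renP κ1 ρ1 κ2 ρ2 (capp k t) = cong (capp _) (renT-renT κ1 ρ1 κ2 ρ2 t)

renV-renV : ∀ (κ1 : Fin m2 → Fin m3) (ρ1 : Fin n2 → Fin n3) (κ2 : Fin m1 → Fin m2) (ρ2 : Fin n1 → Fin n2) v →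
    renV κ1 ρ1 (renV κ2 ρ2 v) ≡ renV (κ1 ∘ κ2) (ρ1 ∘ ρ2) v
renV-renV κ1 ρ1 κ2 ρ2 (vvar x) = refl
renV-renV κ1 ρ1 κ2 ρ2 (vlam t) =
  cong vlam (trans (renT-renT κ1 (ext ρ1) κ2 (ext ρ2) t) (renT-cong (λ _ → refl) (ext-∘ ρ1 ρ2) t))
renV-renV κ1 ρ1 κ2 ρ2 vcc = refl

renE-renE : ∀ (κ1 : Fin m2 → Fin m3) (ρ1 : Fin n2 → Fin n3) (κ2 : Fin m1 → Fin m2) (ρ2 : Fin n1 → Fin n2) E →
    renE κ1 ρ1 (renE κ2 ρ2 E) ≡ renE (κ1 ∘ κ2) (ρ1 ∘ ρ2) E
renE-renE κ1 ρ1 κ2 ρ2 hole = refl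
renE-renE κ1 ρ1 κ2 ρ2 (appR v E) = cong₂ appR (renV-renV κ1 ρ1 κ2 ρ2 v) (renE-renE κ1 ρ1 κ2 ρ2 E)
renE-renE κ1 ρ1 κ2 ρ2 (appL E t) = cong₂ appL (renE-renE κ1 ρ1 κ2 ρ2 E) (renT-renT κ1 ρ1 κ2 ρ2 t)

renF-renF : ∀ (κ1 : Fin m2 → Fin m3) (ρ1 : Fin n2 → Fin n3) (κ2 : Fin m1 → Fin m2) (ρ2 : Fin n1 → Fin n2) F →
    renF κ1 ρ1 (renF κ2 ρ2 F) ≡ renF (κ1 ∘ κ2) (ρ1 ∘ ρ2) F
renF-renF κ1 ρ1 κ2 ρ2 (ectx E) = cong ectx (renE-renE κ1 ρ1 κ2 ρ2 E)
renF-renF κ1 ρ1 κ2 ρ2 (kctx k E) = cong (kctx _) (renE-renE κ1 ρ1 κ2 ρ2 E)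

renT-plugE : ∀ (κ : Fin m → Fin m') (ρ : Fin n → Fin n') E t → renT κ ρ (plugE E t) ≡ plugE (renE κ ρ E) (renT κ ρ t)
renT-plugE κ ρ hole t = refl
renT-plugE κ ρ (appR v E) t = cong₂ app (renT-⌜⌝ κ ρ v) (renT-plugE κ ρ E t)
renT-plugE κ ρ (appL E s) t = cong (λ z → app z (renT κ ρ s)) (renT-plugE κ ρ E t)

renP-plugP : ∀ (κ : Fin m → Fin m') (ρ : Fin n → Fin n') F t → renP κ ρ (plugP F t) ≡ plugP (renF κ ρ F) (renT κ ρ t)
renP-plugP κ ρ (ectx E) t = cong term (renT-plugE κ ρ E t)
renP-plugP κ ρ (kctx k E) t = cong (capp (κ k)) (renT-plugE κ ρ E t)

renE-compE : ∀ (κ : Fin m → Fin m') (ρ : Fin n → Fin n') E E2 →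
  renE κ ρ (compE E E2) ≡ compE (renE κ ρ E) (renE κ ρ E2)
renE-compE κ ρ hole E2 = refl
renE-compE κ ρ (appR v E) E2 = cong (appR _) (renE-compE κ ρ E E2)
renE-compE κ ρ (appL E t) E2 = cong (λ z → appL z _) (renE-compE κ ρ E E2)

renF-compP : ∀ (κ : Fin m → Fin m') (ρ : Fin n → Fin n') F E2 →
  renF κ ρ (compP F E2) ≡ compP (renF κ ρ F) (renE κ ρ E2)
renF-compP κ ρ (ectx E) E2 = cong ectx (renE-compE κ ρ E E2)
renF-compP κ ρ (kctx k E) E2 = cong (kctx _) (renE-compE κ ρ E E2)

record Sub (m0 n0 m n : ℕ) : Set where
  constructor _,,_
  field
    κ : Fin m0 → PCtx m n
    σ : Fin n0 → Val m n
open Sub public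

liftS : Sub m0 n0 m n → Sub m0 (suc n0) m (suc n)
liftS Θ = (wkF ∘ κ Θ) ,, (vvar zero ∷ wkV ∘ σ Θ)

mutual
  substT : Sub m0 n0 m n → Term m0 n0 → Term m n
  substT Θ (var x) = ⌜ σ Θ x ⌝
  substT Θ (lam t) = lam (substT (liftS Θ) t)
  substT Θ (app t s) = app (substT Θ t) (substT Θ s)
  substT Θ callcc = callcc
  substT Θ (abort p) = abort (substP Θ p)

  substP : Sub m0 n0 m n → Prog m0 n0 → Prog m n
  substP Θ (term t) = term (substT Θ t)
  substP Θ (capp k t) = plugP (κ Θ k) (substT Θ t)

substV : Sub m0 n0 m n → Val m0 n0 → Val m n
substV Θ (vvar x) = σ Θ x
substV Θ (vlam t) = vlam (substT (liftS Θ) t)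
substV Θ vcc = vcc

substE : Sub m0 n0 m n → ECtx m0 n0 → ECtx m n
substE Θ hole = hole
substE Θ (appR v E) = appR (substV Θ v) (substE Θ E)
substE Θ (appL E t) = appL (substE Θ E) (substT Θ t)

substF : Sub m0 n0 m n → PCtx m0 n0 → PCtx m n
substF Θ (ectx E) = ectx (substE Θ E)
substF Θ (kctx k E) = compP (κ Θ k) (substE Θ E)

substT-⌜⌝ : ∀ (Θ : Sub m0 n0 m n) v → substT Θ ⌜ v ⌝ ≡ ⌜ substV Θ v ⌝
substT-⌜⌝ Θ (vvar x) = refl
substT-⌜⌝ Θ (vlam t) = refl
substT-⌜⌝ Θ vcc = refl

substT-plugE : ∀ (Θ : Sub m0 n0 m n) E t → substT Θ (plugE E t) ≡ plugE (substE Θ E) (substT Θ t)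
substT-plugE Θ hole t = refl
substT-plugE Θ (appR v E) t = cong₂ app (substT-⌜⌝ Θ v) (substT-plugE Θ E t)
substT-plugE Θ (appL E s) t = cong (λ z → app z (substT Θ s)) (substT-plugE Θ E t)

substP-plugP : ∀ (Θ : Sub m0 n0 m n) F t → substP Θ (plugP F t) ≡ plugP (substF Θ F) (substT Θ t)
substP-plugP Θ (ectx E) t = cong term (substT-plugE Θ E t)
substP-plugP Θ (kctx k E) t =
  trans (cong (plugP (κ Θ k)) (substT-plugE Θ E t)) (sym (plugP-compP (κ Θ k) (substE Θ E) (substT Θ t)))

substE-compE : ∀ (Θ : Sub m0 n0 m n) E E2 → substE Θ (compE E E2) ≡ compE (substE Θ E) (substE Θ E2)
substE-compE Θ hole E2 = refl
substE-compE Θ (appR v E) E2 = cong (appR _) (substE-compE Θ E E2)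
substE-compE Θ (appL E t) E2 = cong (λ z → appL z _) (substE-compE Θ E E2)

substF-compP : ∀ (Θ : Sub m0 n0 m n) F E2 → substF Θ (compP F E2) ≡ compP (substF Θ F) (substE Θ E2)
substF-compP Θ (ectx E) E2 = cong ectx (substE-compE Θ E E2)
substF-compP Θ (kctx k E) E2 =
  trans (cong (compP (κ Θ k)) (substE-compE Θ E E2)) (sym (compP-assoc (κ Θ k) (substE Θ E) (substE Θ E2)))

record _≐_ {m0 n0 m n} (Θ Θ' : Sub m0 n0 m n) : Set where
  constructor mk≐
  field
    eκ : κ Θ ≗ κ Θ'
    eσ : σ Θ ≗ σ Θ'
open _≐_

liftS-cong : {Θ Θ' : Sub m0 n0 m n} → Θ ≐ Θ' → liftS Θ ≐ liftS Θ'
liftS-cong e = mk≐ (λ k → cong wkF (eκ e k)) (λ { zero → refl ; (suc i) → cong wkV (eσ e i) })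

mutual
  substT-cong : {Θ Θ' : Sub m0 n0 m n} → Θ ≐ Θ' → ∀ t → substT Θ t ≡ substT Θ' t
  substT-cong e (var x) = cong ⌜_⌝ (eσ e x)
  substT-cong e (lam t) = cong lam (substT-cong (liftS-cong e) t)
  substT-cong e (app t s) = cong₂ app (substT-cong e t) (substT-cong e s)
  substT-cong e callcc = refl
  substT-cong e (abort p) = cong abort (substP-cong e p)

  substP-cong : {Θ Θ' : Sub m0 n0 m n} → Θ ≐ Θ' → ∀ p → substP Θ p ≡ substP Θ' p
  substP-cong e (term t) = cong term (substT-cong e t)
  substP-cong e (capp k t) = cong₂ plugP (eκ e k) (substT-cong e t)

substV-cong : {Θ Θ' : Sub m0 n0 m n} → Θ ≐ Θ' → ∀ v → substV Θ v ≡ substV Θ' v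
substV-cong e (vvar x) = eσ e x
substV-cong e (vlam t) = cong vlam (substT-cong (liftS-cong e) t)
substV-cong e vcc = refl

substE-cong : {Θ Θ' : Sub m0 n0 m n} → Θ ≐ Θ' → ∀ E → substE Θ E ≡ substE Θ' E
substE-cong e hole = refl
substE-cong e (appR v E) = cong₂ appR (substV-cong e v) (substE-cong e E)
substE-cong e (appL E t) = cong₂ appL (substE-cong e E) (substT-cong e t)

substF-cong : {Θ Θ' : Sub m0 n0 m n} → Θ ≐ Θ' → ∀ F → substF Θ F ≡ substF Θ' F
substF-cong e (ectx E) = cong ectx (substE-cong e E)
substF-cong e (kctx k E) = cong₂ compP (eκ e k) (substE-cong e E)

_∘r_ : Sub m1 n1 m n → (Fin m0 → Fin m1) × (Fin n0 → Fin n1) → Sub m0 n0 m n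
Θ ∘r (κ' , ρ) = (λ k → κ Θ (κ' k)) ,, (λ i → σ Θ (ρ i))

liftS-∘r : (Θ : Sub m1 n1 m n) (κ' : Fin m0 → Fin m1) (ρ : Fin n0 → Fin n1) →
  (liftS Θ ∘r (κ' , ext ρ)) ≐ liftS (Θ ∘r (κ' , ρ))
liftS-∘r Θ κ' ρ = mk≐ (λ k → refl) (λ { zero → refl ; (suc i) → refl })

mutual
  substT-renT : ∀ (Θ : Sub m1 n1 m n) (κ' : Fin m0 → Fin m1) (ρ : Fin n0 → Fin n1) t →
    substT Θ (renT κ' ρ t) ≡ substT (Θ ∘r (κ' , ρ)) t
  substT-renT Θ κ' ρ (var x) = refl
  substT-renT Θ κ' ρ (lam t) = cong lam (trans (substT-renT (liftS Θ) κ' (ext ρ) t) (substT-cong (liftS-∘r Θ κ' ρ) t))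
  substT-renT Θ κ' ρ (app t s) = cong₂ app (substT-renT Θ κ' ρ t) (substT-renT Θ κ' ρ s)
  substT-renT Θ κ' ρ callcc = refl
  substT-renT Θ κ' ρ (abort p) = cong abort (substP-renP Θ κ' ρ p)

  substP-renP : ∀ (Θ : Sub m1 n1 m n) (κ' : Fin m0 → Fin m1) (ρ : Fin n0 → Fin n1) p →
    substP Θ (renP κ' ρ p) ≡ substP (Θ ∘r (κ' , ρ)) p
  substP-renP Θ κ' ρ (term t) = cong term (substT-renT Θ κ' ρ t)
  substP-renP Θ κ' ρ (capp k t) = cong (plugP _) (substT-renT Θ κ' ρ t)

substV-renV : ∀ (Θ : Sub m1 n1 m n) (κ' : Fin m0 → Fin m1) (ρ : Fin n0 → Fin n1) v →
    substV Θ (renV κ' ρ v) ≡ substV (Θ ∘r (κ' , ρ)) v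
substV-renV Θ κ' ρ (vvar x) = refl
substV-renV Θ κ' ρ (vlam t) = cong vlam (trans (substT-renT (liftS Θ) κ' (ext ρ) t) (substT-cong (liftS-∘r Θ κ' ρ) t))
substV-renV Θ κ' ρ vcc = refl

substE-renE : ∀ (Θ : Sub m1 n1 m n) (κ' : Fin m0 → Fin m1) (ρ : Fin n0 → Fin n1) E →
    substE Θ (renE κ' ρ E) ≡ substE (Θ ∘r (κ' , ρ)) E
substE-renE Θ κ' ρ hole = refl
substE-renE Θ κ' ρ (appR v E) = cong₂ appR (substV-renV Θ κ' ρ v) (substE-renE Θ κ' ρ E)
substE-renE Θ κ' ρ (appL E t) = cong₂ appL (substE-renE Θ κ' ρ E) (substT-renT Θ κ' ρ t)

substF-renF : ∀ (Θ : Sub m1 n1 m n) (κ' : Fin m0 → Fin m1) (ρ : Fin n0 → Fin n1) F →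
    substF Θ (renF κ' ρ F) ≡ substF (Θ ∘r (κ' , ρ)) F
substF-renF Θ κ' ρ (ectx E) = cong ectx (substE-renE Θ κ' ρ E)
substF-renF Θ κ' ρ (kctx k E) = cong (compP _) (substE-renE Θ κ' ρ E)

_⨾r_ : Sub m0 n0 m n → (Fin m → Fin m') × (Fin n → Fin n') → Sub m0 n0 m' n'
Θ ⨾r (κ' , ρ) = (λ k → renF κ' ρ (κ Θ k)) ,, (λ i → renV κ' ρ (σ Θ i))

renF-wkF : ∀ (κ' : Fin m → Fin m') (ρ : Fin n → Fin n') F → renF κ' (ext ρ) (wkF F) ≡ wkF (renF κ' ρ F)
renF-wkF κ' ρ F = trans (renF-renF κ' (ext ρ) idF suc F) (sym (renF-renF idF suc κ' ρ F))

renV-wkV : ∀ (κ' : Fin m → Fin m') (ρ : Fin n → Fin n') v → renV κ' (ext ρ) (wkV v) ≡ wkV (renV κ' ρ v)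
renV-wkV κ' ρ v = trans (renV-renV κ' (ext ρ) idF suc v) (sym (renV-renV idF suc κ' ρ v))

liftS-⨾r : (Θ : Sub m0 n0 m n) (κ' : Fin m → Fin m') (ρ : Fin n → Fin n') →
  (liftS Θ ⨾r (κ' , ext ρ)) ≐ liftS (Θ ⨾r (κ' , ρ))
liftS-⨾r Θ κ' ρ = mk≐ (λ k → renF-wkF κ' ρ (κ Θ k)) (λ { zero → refl ; (suc i) → renV-wkV κ' ρ (σ Θ i) })

mutual
  renT-substT : ∀ (Θ : Sub m0 n0 m n) (κ' : Fin m → Fin m') (ρ : Fin n → Fin n') t →
    renT κ' ρ (substT Θ t) ≡ substT (Θ ⨾r (κ' , ρ)) t
  renT-substT Θ κ' ρ (var x) = renT-⌜⌝ κ' ρ (σ Θ x)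
  renT-substT Θ κ' ρ (lam t) = cong lam (trans (renT-substT (liftS Θ) κ' (ext ρ) t) (substT-cong (liftS-⨾r Θ κ' ρ) t))
  renT-substT Θ κ' ρ (app t s) = cong₂ app (renT-substT Θ κ' ρ t) (renT-substT Θ κ' ρ s)
  renT-substT Θ κ' ρ callcc = refl
  renT-substT Θ κ' ρ (abort p) = cong abort (renP-substP Θ κ' ρ p)

  renP-substP : ∀ (Θ : Sub m0 n0 m n) (κ' : Fin m → Fin m') (ρ : Fin n → Fin n') p →
    renP κ' ρ (substP Θ p) ≡ substP (Θ ⨾r (κ' , ρ)) p
  renP-substP Θ κ' ρ (term t) = cong term (renT-substT Θ κ' ρ t)
  renP-substP Θ κ' ρ (capp k t) = trans (renP-plugP κ' ρ (κ Θ k) (substT Θ t)) (cong (plugP _) (renT-substT Θ κ' ρ t))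

renV-substV : ∀ (Θ : Sub m0 n0 m n) (κ' : Fin m → Fin m') (ρ : Fin n → Fin n') v →
    renV κ' ρ (substV Θ v) ≡ substV (Θ ⨾r (κ' , ρ)) v
renV-substV Θ κ' ρ (vvar x) = refl
renV-substV Θ κ' ρ (vlam t) = cong vlam (trans (renT-substT (liftS Θ) κ' (ext ρ) t) (substT-cong (liftS-⨾r Θ κ' ρ) t))
renV-substV Θ κ' ρ vcc = refl

renE-substE : ∀ (Θ : Sub m0 n0 m n) (κ' : Fin m → Fin m') (ρ : Fin n → Fin n') E →
    renE κ' ρ (substE Θ E) ≡ substE (Θ ⨾r (κ' , ρ)) E
renE-substE Θ κ' ρ hole = refl
renE-substE Θ κ' ρ (appR v E) = cong₂ appR (renV-substV Θ κ' ρ v) (renE-substE Θ κ' ρ E)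
renE-substE Θ κ' ρ (appL E t) = cong₂ appL (renE-substE Θ κ' ρ E) (renT-substT Θ κ' ρ t)

renF-substF : ∀ (Θ : Sub m0 n0 m n) (κ' : Fin m → Fin m') (ρ : Fin n → Fin n') F →
    renF κ' ρ (substF Θ F) ≡ substF (Θ ⨾r (κ' , ρ)) F
renF-substF Θ κ' ρ (ectx E) = cong ectx (renE-substE Θ κ' ρ E)
renF-substF Θ κ' ρ (kctx k E) = trans (renF-compP κ' ρ (κ Θ k) (substE Θ E)) (cong (compP _) (renE-substE Θ κ' ρ E))

_⨾_ : Sub m0 n0 m1 n1 → Sub m1 n1 m n → Sub m0 n0 m n
Θ1 ⨾ Θ2 = (λ k → substF Θ2 (κ Θ1 k)) ,, (λ i → substV Θ2 (σ Θ1 i))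

substF-wkF : ∀ (Θ : Sub m1 n1 m n) F → substF (liftS Θ) (wkF F) ≡ wkF (substF Θ F)
substF-wkF Θ F = trans (substF-renF (liftS Θ) idF suc F) (sym (renF-substF Θ idF suc F))

substV-wkV : ∀ (Θ : Sub m1 n1 m n) v → substV (liftS Θ) (wkV v) ≡ wkV (substV Θ v)
substV-wkV Θ v = trans (substV-renV (liftS Θ) idF suc v) (sym (renV-substV Θ idF suc v))

liftS-⨾ : (Θ1 : Sub m0 n0 m1 n1) (Θ2 : Sub m1 n1 m n) → (liftS Θ1 ⨾ liftS Θ2) ≐ liftS (Θ1 ⨾ Θ2)
liftS-⨾ Θ1 Θ2 = mk≐ (λ k → substF-wkF Θ2 (κ Θ1 k)) (λ { zero → refl ; (suc i) → substV-wkV Θ2 (σ Θ1 i) })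

mutual
  substT-substT : ∀ (Θ1 : Sub m0 n0 m1 n1) (Θ2 : Sub m1 n1 m n) t → substT Θ2 (substT Θ1 t) ≡ substT (Θ1 ⨾ Θ2) t
  substT-substT Θ1 Θ2 (var x) = substT-⌜⌝ Θ2 (σ Θ1 x)
  substT-substT Θ1 Θ2 (lam t) =
    cong lam (trans (substT-substT (liftS Θ1) (liftS Θ2) t) (substT-cong (liftS-⨾ Θ1 Θ2) t))
  substT-substT Θ1 Θ2 (app t s) = cong₂ app (substT-substT Θ1 Θ2 t) (substT-substT Θ1 Θ2 s)
  substT-substT Θ1 Θ2 callcc = refl
  substT-substT Θ1 Θ2 (abort p) = cong abort (substP-substP Θ1 Θ2 p)

  substP-substP : ∀ (Θ1 : Sub m0 n0 m1 n1) (Θ2 : Sub m1 n1 m n) p → substP Θ2 (substP Θ1 p) ≡ substP (Θ1 ⨾ Θ2) p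
  substP-substP Θ1 Θ2 (term t) = cong term (substT-substT Θ1 Θ2 t)
  substP-substP Θ1 Θ2 (capp k t) =
    trans (substP-plugP Θ2 (κ Θ1 k) (substT Θ1 t)) (cong (plugP _) (substT-substT Θ1 Θ2 t))

substV-substV : ∀ (Θ1 : Sub m0 n0 m1 n1) (Θ2 : Sub m1 n1 m n) v → substV Θ2 (substV Θ1 v) ≡ substV (Θ1 ⨾ Θ2) v
substV-substV Θ1 Θ2 (vvar x) = refl
substV-substV Θ1 Θ2 (vlam t) =
  cong vlam (trans (substT-substT (liftS Θ1) (liftS Θ2) t) (substT-cong (liftS-⨾ Θ1 Θ2) t))
substV-substV Θ1 Θ2 vcc = refl

substE-substE : ∀ (Θ1 : Sub m0 n0 m1 n1) (Θ2 : Sub m1 n1 m n) E → substE Θ2 (substE Θ1 E) ≡ substE (Θ1 ⨾ Θ2) E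
substE-substE Θ1 Θ2 hole = refl
substE-substE Θ1 Θ2 (appR v E) = cong₂ appR (substV-substV Θ1 Θ2 v) (substE-substE Θ1 Θ2 E)
substE-substE Θ1 Θ2 (appL E t) = cong₂ appL (substE-substE Θ1 Θ2 E) (substT-substT Θ1 Θ2 t)

substF-substF : ∀ (Θ1 : Sub m0 n0 m1 n1) (Θ2 : Sub m1 n1 m n) F → substF Θ2 (substF Θ1 F) ≡ substF (Θ1 ⨾ Θ2) F
substF-substF Θ1 Θ2 (ectx E) = cong ectx (substE-substE Θ1 Θ2 E)
substF-substF Θ1 Θ2 (kctx k E) =
  trans (substF-compP Θ2 (κ Θ1 k) (substE Θ1 E)) (cong (compP _) (substE-substE Θ1 Θ2 E))

idS : Sub m n m n
idS = (λ k → kctx k hole) ,, vvar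

consK : PCtx m n → Sub m0 n0 m n → Sub (suc m0) n0 m n
consK F Θ = (F ∷ κ Θ) ,, σ Θ

consV : Val m n → Sub m0 n0 m n → Sub m0 (suc n0) m n
consV v Θ = κ Θ ,, (v ∷ σ Θ)

liftS-idS : liftS (idS {m} {n}) ≐ idS
liftS-idS = mk≐ (λ k → refl) (λ { zero → refl ; (suc i) → refl })

mutual
  substT-idS : (t : Term m n) → substT idS t ≡ t
  substT-idS (var x) = refl
  substT-idS (lam t) = cong lam (trans (substT-cong liftS-idS t) (substT-idS t))
  substT-idS (app t s) = cong₂ app (substT-idS t) (substT-idS s)
  substT-idS callcc = refl
  substT-idS (abort p) = cong abort (substP-idS p)

  substP-idS : (p : Prog m n) → substP idS p ≡ p
  substP-idS (term t) = cong term (substT-idS t)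
  substP-idS (capp k t) = cong (capp k) (substT-idS t)

substV-idS : (v : Val m n) → substV idS v ≡ v
substV-idS (vvar x) = refl
substV-idS (vlam t) = cong vlam (trans (substT-cong liftS-idS t) (substT-idS t))
substV-idS vcc = refl

substE-idS : (E : ECtx m n) → substE idS E ≡ E
substE-idS hole = refl
substE-idS (appR v E) = cong₂ appR (substV-idS v) (substE-idS E)
substE-idS (appL E t) = cong₂ appL (substE-idS E) (substT-idS t)

substF-idS : (F : PCtx m n) → substF idS F ≡ F
substF-idS (ectx E) = cong ectx (substE-idS E)
substF-idS (kctx k E) = cong (kctx k) (substE-idS E)

mutual
  subT-substT : (τ : Fin n → Term m n') (Θ : Sub m n m n') →
    (∀ x → τ x ≡ ⌜ σ Θ x ⌝) → (∀ k → κ Θ k ≡ kctx k hole) → ∀ t → subT τ t ≡ substT Θ t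
  subT-substT τ Θ eτ eκ (var x) = eτ x
  subT-substT τ Θ eτ eκ (lam t) = cong lam (subT-substT (exts τ) (liftS Θ) eτ' (λ k → cong wkF (eκ k)) t)
    where
    eτ' : ∀ x → exts τ x ≡ ⌜ σ (liftS Θ) x ⌝
    eτ' zero = refl
    eτ' (suc i) = trans (cong wkT (eτ i)) (renT-⌜⌝ idF suc (σ Θ i))
  subT-substT τ Θ eτ eκ (app t s) = cong₂ app (subT-substT τ Θ eτ eκ t) (subT-substT τ Θ eτ eκ s)
  subT-substT τ Θ eτ eκ callcc = refl
  subT-substT τ Θ eτ eκ (abort p) = cong abort (subP-substP τ Θ eτ eκ p)

  subP-substP : (τ : Fin n → Term m n') (Θ : Sub m n m n') →
    (∀ x → τ x ≡ ⌜ σ Θ x ⌝) → (∀ k → κ Θ k ≡ kctx k hole) → ∀ p → subP τ p ≡ substP Θ p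
  subP-substP τ Θ eτ eκ (term t) = cong term (subT-substT τ Θ eτ eκ t)
  subP-substP τ Θ eτ eκ (capp k t) =
    trans (cong (capp k) (subT-substT τ Θ eτ eκ t)) (cong (λ F → plugP F (substT Θ t)) (sym (eκ k)))

singleS : Val m n → Sub m (suc n) m n
singleS v = consV v idS

[]-substT : (t : Term m (suc n)) (v : Val m n) → t [ v ] ≡ substT (singleS v) t
[]-substT t v = subT-substT (single v) (singleS v) (λ { zero → refl ; (suc i) → refl }) (λ k → refl) t

substF-singleS-wkF : ∀ (u : Val m n) F → substF (singleS u) (wkF F) ≡ F
substF-singleS-wkF u F = trans (substF-renF (singleS u) idF suc F) (substF-idS F)

substV-singleS-wkV : ∀ (u : Val m n) v → substV (singleS u) (wkV v) ≡ v
substV-singleS-wkV u v = trans (substV-renV (singleS u) idF suc v) (substV-idS v)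

substT-[] : ∀ (Θ : Sub m0 n0 m n) t v → substT Θ (t [ v ]) ≡ substT (liftS Θ) t [ substV Θ v ]
substT-[] Θ t v = begin
  substT Θ (t [ v ])                                  ≡⟨ cong (substT Θ) ([]-substT t v) ⟩
  substT Θ (substT (singleS v) t)                     ≡⟨ substT-substT (singleS v) Θ t ⟩
  substT (singleS v ⨾ Θ) t                            ≡⟨ substT-cong (mk≐ κ-agree σ-agree) t ⟩
  substT (liftS Θ ⨾ singleS (substV Θ v)) t           ≡⟨ substT-substT (liftS Θ) (singleS (substV Θ v)) t ⟨
  substT (singleS (substV Θ v)) (substT (liftS Θ) t)  ≡⟨ []-substT (substT (liftS Θ) t) (substV Θ v) ⟨
  substT (liftS Θ) t [ substV Θ v ]                   ∎
  where
  κ-agree : ∀ k → compP (κ Θ k) hole ≡ substF (singleS (substV Θ v)) (wkF (κ Θ k))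
  κ-agree k = trans (compP-identityʳ (κ Θ k)) (sym (substF-singleS-wkF (substV Θ v) (κ Θ k)))
  σ-agree : ∀ i → substV Θ (σ (singleS v) i) ≡ substV (singleS (substV Θ v)) (σ (liftS Θ) i)
  σ-agree zero = refl
  σ-agree (suc i) = sym (substV-singleS-wkV (substV Θ v) (σ Θ i))

substP-plugP-app : ∀ (Θ : Sub m0 n0 m n) F t v →
  substP Θ (plugP F (app t ⌜ v ⌝)) ≡ plugP (substF Θ F) (app (substT Θ t) ⌜ substV Θ v ⌝)
substP-plugP-app Θ F t v =
  trans (substP-plugP Θ F _) (cong (plugP (substF Θ F) ∘ app (substT Θ t)) (substT-⌜⌝ Θ v))

substP-plugP-wkF : ∀ (Θ : Sub m0 n0 m n) F →
  substP (liftS Θ) (plugP (wkF F) (var zero)) ≡ plugP (wkF (substF Θ F)) (var zero)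
substP-plugP-wkF Θ F =
  trans (substP-plugP (liftS Θ) (wkF F) (var zero)) (cong (λ G → plugP G (var zero)) (substF-wkF Θ F))

substP-⟶ : (Θ : Sub m0 n0 m n) {p p' : Prog m0 n0} → p ⟶ p' → substP Θ p ⟶ substP Θ p'
substP-⟶ Θ (β F t v) =
  subst₂ _⟶_ (sym (substP-plugP-app Θ F (lam t) v)) (sym contractum)
    (β (substF Θ F) (substT (liftS Θ) t) (substV Θ v))
  where
  contractum : substP Θ (plugP F (t [ v ])) ≡ plugP (substF Θ F) (substT (liftS Θ) t [ substV Θ v ])
  contractum = trans (substP-plugP Θ F (t [ v ])) (cong (plugP (substF Θ F)) (substT-[] Θ t v))
substP-⟶ Θ (ccRed F v) =
  subst₂ _⟶_ (sym (substP-plugP-app Θ F callcc v)) (sym contractum) (ccRed (substF Θ F) (substV Θ v))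
  where
  contractum : substP Θ (plugP F (app ⌜ v ⌝ (lam (abort (plugP (wkF F) (var zero)))))) ≡
               plugP (substF Θ F) (app ⌜ substV Θ v ⌝ (lam (abort (plugP (wkF (substF Θ F)) (var zero)))))
  contractum = trans (substP-plugP Θ F _)
    (cong₂ (λ a b → plugP (substF Θ F) (app a (lam (abort b)))) (substT-⌜⌝ Θ v) (substP-plugP-wkF Θ F))
substP-⟶ Θ (abRed F p) = subst (_⟶ substP Θ p) (sym (substP-plugP Θ F (abort p))) (abRed (substF Θ F) (substP Θ p))

substP-⟶* : (Θ : Sub m0 n0 m n) {p p' : Prog m0 n0} → p ⟶* p' → substP Θ p ⟶* substP Θ p'
substP-⟶* Θ = gmap (substP Θ) (substP-⟶ Θ)

≡⇒⟶* : {p q : Prog m n} → p ≡ q → p ⟶* q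
≡⇒⟶* refl = ε

-- Decomposition and determinism of reduction

data Redex {m n} : Term m n → Set where
  redβ     : (t : Term m (suc n)) (v : Val m n) → Redex (app (lam t) ⌜ v ⌝)
  redcc    : (v : Val m n) → Redex (app callcc ⌜ v ⌝)
  redabort : (p : Prog m n) → Redex (abort p)

plugP-redex-⟶ : {r : Term m n} → Redex r → (F : PCtx m n) → ∃[ p' ] (plugP F r ⟶ p')
plugP-redex-⟶ (redβ t v) F = _ , β F t v
plugP-redex-⟶ (redcc v) F = _ , ccRed F v
plugP-redex-⟶ (redabort p) F = _ , abRed F p

⟶-redex : {p p' : Prog m n} → p ⟶ p' → ∃[ F ] ∃[ r ] (Redex r × p ≡ plugP F r)
⟶-redex (β F t v) = F , _ , redβ t v , refl
⟶-redex (ccRed F v) = F , _ , redcc v , refl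
⟶-redex (abRed F p) = F , _ , redabort p , refl

data TermView (t : Term m n) : Set where
  value : (v : Val m n) → t ≡ ⌜ v ⌝ → TermView t
  redex : (E : ECtx m n) {r : Term m n} → Redex r → t ≡ plugE E r → TermView t
  stuck : (E : ECtx m n) (x : Fin n) (v : Val m n) → t ≡ plugE E (app (var x) ⌜ v ⌝) → TermView t

termView-app-values : {t s : Term m n} (v w : Val m n) → t ≡ ⌜ v ⌝ → s ≡ ⌜ w ⌝ → TermView (app t s)
termView-app-values (vvar x) w refl refl = stuck hole x w refl
termView-app-values (vlam b) w refl refl = redex hole (redβ b w) refl
termView-app-values vcc w refl refl = redex hole (redcc w) refl

termView : (t : Term m n) → TermView t
termView (var x) = value (vvar x) refl
termView (lam t) = value (vlam t) refl
termView callcc = value vcc refl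
termView (abort p) = redex hole (redabort p) refl
termView (app t s) with termView t
... | redex E R refl = redex (appL E s) R refl
... | stuck E x v refl = stuck (appL E s) x v refl
... | value v eq with termView s
...   | redex E R refl = redex (appR v E) R (cong (λ z → app z _) eq)
...   | stuck E x w refl = stuck (appR v E) x w (cong (λ z → app z _) eq)
...   | value w eq' = termView-app-values v w eq eq'

data ProgView (p : Prog m n) : Set where
  step   : (p' : Prog m n) → p ⟶ p' → ProgView p
  value  : (v : Val m n) → p ≡ term ⌜ v ⌝ → ProgView p
  kvalue : (k : Fin m) (v : Val m n) → p ≡ capp k ⌜ v ⌝ → ProgView p
  stuck  : (F : PCtx m n) (x : Fin n) (v : Val m n) → p ≡ plugP F (app (var x) ⌜ v ⌝) → ProgView p

progView-redex : (F : PCtx m n) {r : Term m n} → Redex r → ProgView (plugP F r)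
progView-redex F R = let (p' , st) = plugP-redex-⟶ R F in step p' st

progView : (p : Prog m n) → ProgView p
progView (term t) with termView t
... | value v refl = value v refl
... | redex E R refl = progView-redex (ectx E) R
... | stuck E x v refl = stuck (ectx E) x v refl
progView (capp k t) with termView t
... | value v refl = kvalue k v refl
... | redex E R refl = progView-redex (kctx k E) R
... | stuck E x v refl = stuck (kctx k E) x v refl

IsValue : Term m n → Set
IsValue (var _)   = ⊤
IsValue (lam _)   = ⊤
IsValue callcc    = ⊤
IsValue (app _ _) = ⊥
IsValue (abort _) = ⊥

⌜⌝-isValue : (v : Val m n) → IsValue ⌜ v ⌝
⌜⌝-isValue (vvar x) = tt
⌜⌝-isValue (vlam t) = tt
⌜⌝-isValue vcc      = tt

plugE-redex-notValue : {r : Term m n} → Redex r → (E : ECtx m n) → ¬ IsValue (plugE E r)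
plugE-redex-notValue (redβ _ _)   hole ()
plugE-redex-notValue (redcc _)    hole ()
plugE-redex-notValue (redabort _) hole ()
plugE-redex-notValue R (appR _ _) ()
plugE-redex-notValue R (appL _ _) ()

⌜⌝≢plugE-redex : {r : Term m n} → Redex r → (E : ECtx m n) (v : Val m n) → ⌜ v ⌝ ≢ plugE E r
⌜⌝≢plugE-redex R E v eq = plugE-redex-notValue R E (subst IsValue eq (⌜⌝-isValue v))

toVal : Term m n → Val m n
toVal (var x) = vvar x
toVal (lam t) = vlam t
toVal _       = vcc

toVal-⌜⌝ : (v : Val m n) → toVal ⌜ v ⌝ ≡ v
toVal-⌜⌝ (vvar x) = refl
toVal-⌜⌝ (vlam t) = refl
toVal-⌜⌝ vcc      = refl

⌜⌝-injective : {v w : Val m n} → ⌜ v ⌝ ≡ ⌜ w ⌝ → v ≡ w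
⌜⌝-injective {v = v} {w} eq = trans (sym (toVal-⌜⌝ v)) (trans (cong toVal eq) (toVal-⌜⌝ w))

app-injective : {a b c d : Term m n} → app a b ≡ app c d → a ≡ c × b ≡ d
app-injective refl = refl , refl

term-injective : {t t' : Term m n} → term t ≡ term t' → t ≡ t'
term-injective refl = refl

capp-injective : {k k' : Fin m} {t t' : Term m n} → capp k t ≡ capp k' t' → k ≡ k' × t ≡ t'
capp-injective refl = refl , refl

plugE-redex-unique : {r r' : Term m n} (E E' : ECtx m n) → Redex r → Redex r' →
  plugE E r ≡ plugE E' r' → E ≡ E' × r ≡ r'
plugE-redex-unique hole hole R R' eq = refl , eq
plugE-redex-unique hole (appR _ E') (redβ t w) R' eq = ⊥-elim (⌜⌝≢plugE-redex R' E' w (proj₂ (app-injective eq)))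
plugE-redex-unique hole (appR _ E') (redcc w) R' eq = ⊥-elim (⌜⌝≢plugE-redex R' E' w (proj₂ (app-injective eq)))
plugE-redex-unique hole (appL E' _) (redβ t w) R' eq =
  ⊥-elim (⌜⌝≢plugE-redex R' E' (vlam t) (proj₁ (app-injective eq)))
plugE-redex-unique hole (appL E' _) (redcc w) R' eq = ⊥-elim (⌜⌝≢plugE-redex R' E' vcc (proj₁ (app-injective eq)))
plugE-redex-unique (appR _ E) hole R (redβ t w) eq = ⊥-elim (⌜⌝≢plugE-redex R E w (sym (proj₂ (app-injective eq))))
plugE-redex-unique (appR _ E) hole R (redcc w) eq = ⊥-elim (⌜⌝≢plugE-redex R E w (sym (proj₂ (app-injective eq))))
plugE-redex-unique (appL E _) hole R (redβ t w) eq =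
  ⊥-elim (⌜⌝≢plugE-redex R E (vlam t) (sym (proj₁ (app-injective eq))))
plugE-redex-unique (appL E _) hole R (redcc w) eq = ⊥-elim (⌜⌝≢plugE-redex R E vcc (sym (proj₁ (app-injective eq))))
plugE-redex-unique (appR v E) (appL E' _) R R' eq = ⊥-elim (⌜⌝≢plugE-redex R' E' v (proj₁ (app-injective eq)))
plugE-redex-unique (appL E _) (appR v' E') R R' eq = ⊥-elim (⌜⌝≢plugE-redex R E v' (sym (proj₁ (app-injective eq))))
plugE-redex-unique (appR v E) (appR v' E') R R' eq with app-injective eq
... | eqv , eqE with ⌜⌝-injective eqv | plugE-redex-unique E E' R R' eqE
... | refl | refl , eqr = refl , eqr
plugE-redex-unique (appL E s) (appL E' s') R R' eq with app-injective eq
... | eqE , refl with plugE-redex-unique E E' R R' eqE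
... | refl , eqr = refl , eqr

plugP-redex-unique : {r r' : Term m n} (F F' : PCtx m n) → Redex r → Redex r' →
  plugP F r ≡ plugP F' r' → F ≡ F' × r ≡ r'
plugP-redex-unique (ectx E) (ectx E') R R' eq with plugE-redex-unique E E' R R' (term-injective eq)
... | refl , eqr = refl , eqr
plugP-redex-unique (kctx k E) (kctx k' E') R R' eq with capp-injective eq
... | refl , eqE with plugE-redex-unique E E' R R' eqE
... | refl , eqr = refl , eqr

⟶-deterministic : {p q p₁ p₂ : Prog m n} → p ⟶ p₁ → q ⟶ p₂ → p ≡ q → p₁ ≡ p₂
⟶-deterministic (β F t v) (β F' t' v') eq with plugP-redex-unique F F' (redβ t v) (redβ t' v') eq
... | refl , eqr with app-injective eqr
... | refl , eqv with ⌜⌝-injective eqv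
... | refl = refl
⟶-deterministic (β F t v) (ccRed F' v') eq with plugP-redex-unique F F' (redβ t v) (redcc v') eq
... | refl , ()
⟶-deterministic (β F t v) (abRed F' p) eq with plugP-redex-unique F F' (redβ t v) (redabort p) eq
... | refl , ()
⟶-deterministic (ccRed F v) (β F' t' v') eq with plugP-redex-unique F F' (redcc v) (redβ t' v') eq
... | refl , ()
⟶-deterministic (ccRed F v) (ccRed F' v') eq with plugP-redex-unique F F' (redcc v) (redcc v') eq
... | refl , eqr with ⌜⌝-injective (proj₂ (app-injective eqr))
... | refl = refl
⟶-deterministic (ccRed F v) (abRed F' p) eq with plugP-redex-unique F F' (redcc v) (redabort p) eq
... | refl , ()
⟶-deterministic (abRed F p) (β F' t' v') eq with plugP-redex-unique F F' (redabort p) (redβ t' v') eq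
... | refl , ()
⟶-deterministic (abRed F p) (ccRed F' v') eq with plugP-redex-unique F F' (redabort p) (redcc v') eq
... | refl , ()
⟶-deterministic (abRed F p) (abRed F' p') eq with plugP-redex-unique F F' (redabort p) (redabort p') eq
... | refl , refl = refl

value-irreducible : (w : Val m n) → Irreducible (term ⌜ w ⌝)
value-irreducible w (_ , st) with ⟶-redex st
... | ectx E , _ , R , eq = ⌜⌝≢plugE-redex R E w (term-injective eq)
... | kctx _ _ , _ , _ , ()

-- The candidate relation

≈-sym : {p q : Prog m n} → p ≈ q → q ≈ p
≈-sym (R , (progress , progress⁻¹) , pRq) = flipR R , (progress⁻¹ , progress) , pRq

≈-red : {p q p' : Prog m n} → p ≈ q → p ⟶ p' → ∃[ q' ] (q ⟶* q' × p' ≈ q')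
≈-red (R , bisim , pRq) st =
  let (q' , red , p'Rq') = Progress.red (proj₁ bisim) pRq st in q' , red , (R , bisim , p'Rq')

≈-value : {p q : Prog m n} {v : Val m n} → p ≈ q → p ≡ term ⌜ v ⌝ → ∃[ w ] (q ⟶* term ⌜ w ⌝)
≈-value (R , bisim , pRq) eq =
  let (w , red , _) = Progress.value (proj₁ bisim) pRq _ eq in w , red

≈-kvalue : {p q : Prog m n} {k : Fin m} {v : Val m n} → p ≈ q → p ≡ capp k ⌜ v ⌝ →
  ∃[ w ] (q ⟶* capp k ⌜ w ⌝ × (_≈_ ^v) v w)
≈-kvalue (R , bisim , pRq) eq =
  let (w , (red , _) , vRw) = Progress.kvalue (proj₁ bisim) pRq _ _ eq in w , red , (R , bisim , vRw)

≈-stuck : {p q : Prog m n} {F : PCtx m n} {x : Fin n} {v : Val m n} → p ≈ q → p ≡ plugP F (app (var x) ⌜ v ⌝) →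
  ∃[ F' ] ∃[ w ] (q ⟶* plugP F' (app (var x) ⌜ w ⌝) × (_≈_ ^E) F F' × (_≈_ ^v) v w)
≈-stuck (R , bisim , pRq) eq =
  let (F' , w , (red , _) , FRF' , vRw) = Progress.open-stuck (proj₁ bisim) pRq _ _ _ eq
  in F' , w , red , (R , bisim , FRF') , (R , bisim , vRw)

mutual
  data _∼T_ {n : ℕ} : Term 0 n → Term 0 n → Set₁ where
    t-val : ∀ {v w} → v ∼V w → ⌜ v ⌝ ∼T ⌜ w ⌝
    t-app : ∀ {t t' s s'} → t ∼T t' → s ∼T s' → app t s ∼T app t' s'
    t-abort : ∀ {p p'} → p ∼P p' → abort p ∼T abort p'
    t-base : {t₀ s₀ : Term m0 n0} {Θ Θ' : Sub m0 n0 0 n} → (_≈_ ^t) t₀ s₀ → Θ ∼S Θ' → substT Θ t₀ ∼T substT Θ' s₀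

  data _∼V_ {n : ℕ} : Val 0 n → Val 0 n → Set₁ where
    v-var : ∀ x → vvar x ∼V vvar x
    v-lam : ∀ {b b'} → b ∼T b' → vlam b ∼V vlam b'
    v-cc : vcc ∼V vcc
    v-base : {v₀ w₀ : Val m0 n0} {Θ Θ' : Sub m0 n0 0 n} → (_≈_ ^v) v₀ w₀ → Θ ∼S Θ' → substV Θ v₀ ∼V substV Θ' w₀

  data _∼F_ {n : ℕ} : PCtx 0 n → PCtx 0 n → Set₁ where
    f-hole : ectx hole ∼F ectx hole
    f-appL : ∀ {F F' t t'} → F ∼F F' → t ∼T t' → compP F (appL hole t) ∼F compP F' (appL hole t')
    f-appR : ∀ {F F' v v'} → F ∼F F' → v ∼V v' → compP F (appR v hole) ∼F compP F' (appR v' hole)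
    f-base : {F₀ G₀ : PCtx m0 n0} {Θ Θ' : Sub m0 n0 0 n} → (_≈_ ^E) F₀ G₀ → Θ ∼S Θ' → substF Θ F₀ ∼F substF Θ' G₀

  data _∼P_ {n : ℕ} : Prog 0 n → Prog 0 n → Set₁ where
    p-plug : ∀ {F F' t t'} → F ∼F F' → t ∼T t' → plugP F t ∼P plugP F' t'
    p-base : {p₀ q₀ : Prog m0 n0} {Θ Θ' : Sub m0 n0 0 n} → p₀ ≈ q₀ → Θ ∼S Θ' → substP Θ p₀ ∼P substP Θ' q₀

  data _∼S_ {m0 n0 n : ℕ} : Sub m0 n0 0 n → Sub m0 n0 0 n → Set₁ where
    mk∼S : ∀ {Θ Θ'} → (∀ k → κ Θ k ∼F κ Θ' k) → (∀ x → σ Θ x ∼V σ Θ' x) → Θ ∼S Θ'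

mutual
  ∼T-ren : ∀ (ρ : Fin n → Fin n') {t t'} → t ∼T t' → renT idF ρ t ∼T renT idF ρ t'
  ∼T-ren ρ (t-val {v} {w} v∼) = subst₂ _∼T_ (sym (renT-⌜⌝ idF ρ v)) (sym (renT-⌜⌝ idF ρ w)) (t-val (∼V-ren ρ v∼))
  ∼T-ren ρ (t-app t∼ s∼) = t-app (∼T-ren ρ t∼) (∼T-ren ρ s∼)
  ∼T-ren ρ (t-abort p∼) = t-abort (∼P-ren ρ p∼)
  ∼T-ren ρ (t-base {t₀ = t₀} {s₀} {Θ} {Θ'} A Θ∼) =
    subst₂ _∼T_ (sym (renT-substT Θ idF ρ t₀)) (sym (renT-substT Θ' idF ρ s₀)) (t-base A (∼S-ren ρ Θ∼))

  ∼V-ren : ∀ (ρ : Fin n → Fin n') {v v'} → v ∼V v' → renV idF ρ v ∼V renV idF ρ v'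
  ∼V-ren ρ (v-var x) = v-var (ρ x)
  ∼V-ren ρ (v-lam b∼) = v-lam (∼T-ren (ext ρ) b∼)
  ∼V-ren ρ v-cc = v-cc
  ∼V-ren ρ (v-base {v₀ = v₀} {w₀} {Θ} {Θ'} A Θ∼) =
    subst₂ _∼V_ (sym (renV-substV Θ idF ρ v₀)) (sym (renV-substV Θ' idF ρ w₀)) (v-base A (∼S-ren ρ Θ∼))

  ∼F-ren : ∀ (ρ : Fin n → Fin n') {F F'} → F ∼F F' → renF idF ρ F ∼F renF idF ρ F'
  ∼F-ren ρ f-hole = f-hole
  ∼F-ren ρ (f-appL {F} {F'} {t} {t'} F∼ t∼) =
    subst₂ _∼F_ (sym (renF-compP idF ρ F (appL hole t))) (sym (renF-compP idF ρ F' (appL hole t')))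
      (f-appL (∼F-ren ρ F∼) (∼T-ren ρ t∼))
  ∼F-ren ρ (f-appR {F} {F'} {v} {v'} F∼ v∼) =
    subst₂ _∼F_ (sym (renF-compP idF ρ F (appR v hole))) (sym (renF-compP idF ρ F' (appR v' hole)))
      (f-appR (∼F-ren ρ F∼) (∼V-ren ρ v∼))
  ∼F-ren ρ (f-base {F₀ = F₀} {G₀} {Θ} {Θ'} A Θ∼) =
    subst₂ _∼F_ (sym (renF-substF Θ idF ρ F₀)) (sym (renF-substF Θ' idF ρ G₀)) (f-base A (∼S-ren ρ Θ∼))

  ∼P-ren : ∀ (ρ : Fin n → Fin n') {p p'} → p ∼P p' → renP idF ρ p ∼P renP idF ρ p'
  ∼P-ren ρ (p-plug {F} {F'} {t} {t'} F∼ t∼) =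
    subst₂ _∼P_ (sym (renP-plugP idF ρ F t)) (sym (renP-plugP idF ρ F' t')) (p-plug (∼F-ren ρ F∼) (∼T-ren ρ t∼))
  ∼P-ren ρ (p-base {p₀ = p₀} {q₀} {Θ} {Θ'} A Θ∼) =
    subst₂ _∼P_ (sym (renP-substP Θ idF ρ p₀)) (sym (renP-substP Θ' idF ρ q₀)) (p-base A (∼S-ren ρ Θ∼))

  ∼S-ren : (ρ : Fin n → Fin n') {Θ Θ' : Sub m0 n0 0 n} → Θ ∼S Θ' → (Θ ⨾r (idF , ρ)) ∼S (Θ' ⨾r (idF , ρ))
  ∼S-ren ρ (mk∼S κ∼ σ∼) = mk∼S (λ k → ∼F-ren ρ (κ∼ k)) (λ x → ∼V-ren ρ (σ∼ x))

∼S-liftS : {Θ Θ' : Sub m0 n0 0 n} → Θ ∼S Θ' → liftS Θ ∼S liftS Θ'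
∼S-liftS (mk∼S κ∼ σ∼) = mk∼S (λ k → ∼F-ren suc (κ∼ k)) (λ { zero → v-var zero ; (suc i) → ∼V-ren suc (σ∼ i) })

mutual
  ∼T-subst : {τ τ' : Sub 0 n 0 n'} → τ ∼S τ' → ∀ {t t'} → t ∼T t' → substT τ t ∼T substT τ' t'
  ∼T-subst {τ = τ} {τ'} τ∼ (t-val {v} {w} v∼) =
    subst₂ _∼T_ (sym (substT-⌜⌝ τ v)) (sym (substT-⌜⌝ τ' w)) (t-val (∼V-subst τ∼ v∼))
  ∼T-subst τ∼ (t-app t∼ s∼) = t-app (∼T-subst τ∼ t∼) (∼T-subst τ∼ s∼)
  ∼T-subst τ∼ (t-abort p∼) = t-abort (∼P-subst τ∼ p∼)
  ∼T-subst {τ = τ} {τ'} τ∼ (t-base {t₀ = t₀} {s₀} {Θ} {Θ'} A Θ∼) =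
    subst₂ _∼T_ (sym (substT-substT Θ τ t₀)) (sym (substT-substT Θ' τ' s₀)) (t-base A (∼S-subst τ∼ Θ∼))

  ∼V-subst : {τ τ' : Sub 0 n 0 n'} → τ ∼S τ' → ∀ {v v'} → v ∼V v' → substV τ v ∼V substV τ' v'
  ∼V-subst (mk∼S κ∼ σ∼) (v-var x) = σ∼ x
  ∼V-subst τ∼ (v-lam b∼) = v-lam (∼T-subst (∼S-liftS τ∼) b∼)
  ∼V-subst τ∼ v-cc = v-cc
  ∼V-subst {τ = τ} {τ'} τ∼ (v-base {v₀ = v₀} {w₀} {Θ} {Θ'} A Θ∼) =
    subst₂ _∼V_ (sym (substV-substV Θ τ v₀)) (sym (substV-substV Θ' τ' w₀)) (v-base A (∼S-subst τ∼ Θ∼))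

  ∼F-subst : {τ τ' : Sub 0 n 0 n'} → τ ∼S τ' → ∀ {F F'} → F ∼F F' → substF τ F ∼F substF τ' F'
  ∼F-subst τ∼ f-hole = f-hole
  ∼F-subst {τ = τ} {τ'} τ∼ (f-appL {F} {F'} {t} {t'} F∼ t∼) =
    subst₂ _∼F_ (sym (substF-compP τ F (appL hole t))) (sym (substF-compP τ' F' (appL hole t')))
      (f-appL (∼F-subst τ∼ F∼) (∼T-subst τ∼ t∼))
  ∼F-subst {τ = τ} {τ'} τ∼ (f-appR {F} {F'} {v} {v'} F∼ v∼) =
    subst₂ _∼F_ (sym (substF-compP τ F (appR v hole))) (sym (substF-compP τ' F' (appR v' hole)))
      (f-appR (∼F-subst τ∼ F∼) (∼V-subst τ∼ v∼))
  ∼F-subst {τ = τ} {τ'} τ∼ (f-base {F₀ = F₀} {G₀} {Θ} {Θ'} A Θ∼) =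
    subst₂ _∼F_ (sym (substF-substF Θ τ F₀)) (sym (substF-substF Θ' τ' G₀)) (f-base A (∼S-subst τ∼ Θ∼))

  ∼P-subst : {τ τ' : Sub 0 n 0 n'} → τ ∼S τ' → ∀ {p p'} → p ∼P p' → substP τ p ∼P substP τ' p'
  ∼P-subst {τ = τ} {τ'} τ∼ (p-plug {F} {F'} {t} {t'} F∼ t∼) =
    subst₂ _∼P_ (sym (substP-plugP τ F t)) (sym (substP-plugP τ' F' t')) (p-plug (∼F-subst τ∼ F∼) (∼T-subst τ∼ t∼))
  ∼P-subst {τ = τ} {τ'} τ∼ (p-base {p₀ = p₀} {q₀} {Θ} {Θ'} A Θ∼) =
    subst₂ _∼P_ (sym (substP-substP Θ τ p₀)) (sym (substP-substP Θ' τ' q₀)) (p-base A (∼S-subst τ∼ Θ∼))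

  ∼S-subst : {τ τ' : Sub 0 n 0 n'} → τ ∼S τ' → ∀ {Θ Θ' : Sub m0 n0 0 n} → Θ ∼S Θ' → (Θ ⨾ τ) ∼S (Θ' ⨾ τ')
  ∼S-subst τ∼ (mk∼S κ∼ σ∼) = mk∼S (λ k → ∼F-subst τ∼ (κ∼ k)) (λ x → ∼V-subst τ∼ (σ∼ x))

∼S-idS : idS {0} {n} ∼S idS
∼S-idS = mk∼S (λ ()) v-var

∼S-consK : {F F' : PCtx 0 n} {Θ Θ' : Sub m0 n0 0 n} → F ∼F F' → Θ ∼S Θ' → consK F Θ ∼S consK F' Θ'
∼S-consK F∼ (mk∼S κ∼ σ∼) = mk∼S (λ { zero → F∼ ; (suc k) → κ∼ k }) σ∼

∼S-consV : {v v' : Val 0 n} {Θ Θ' : Sub m0 n0 0 n} → v ∼V v' → Θ ∼S Θ' → consV v Θ ∼S consV v' Θ'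
∼S-consV v∼ (mk∼S κ∼ σ∼) = mk∼S κ∼ (λ { zero → v∼ ; (suc x) → σ∼ x })

∼T-[] : {b b' : Term 0 (suc n)} {u u' : Val 0 n} → b ∼T b' → u ∼V u' → (b [ u ]) ∼T (b' [ u' ])
∼T-[] {b = b} {b'} {u} {u'} b∼ u∼ =
  subst₂ _∼T_ (sym ([]-substT b u)) (sym ([]-substT b' u')) (∼T-subst (∼S-consV u∼ ∼S-idS) b∼)

plugP-substT-consK : ∀ (F : PCtx m n) (Θ : Sub m0 n0 m n) t →
  plugP F (substT Θ t) ≡ substP (consK F Θ) (capp zero (wkKT t))
plugP-substT-consK F Θ t = cong (plugP F) (sym (substT-renT (consK F Θ) suc idF t))

plugP-substF-consV : ∀ (Θ : Sub m0 n0 m n) F v →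
  plugP (substF Θ F) ⌜ v ⌝ ≡ substP (consV v Θ) (plugP (wkF F) (var zero))
plugP-substF-consV Θ F v = sym (trans (substP-plugP (consV v Θ) (wkF F) (var zero))
  (cong (λ G → plugP G ⌜ v ⌝) (substF-renF (consV v Θ) idF suc F)))

plugP-app-consK-consV : ∀ (F : PCtx m n) (Θ : Sub m0 n0 m n) v u →
  plugP F (app ⌜ substV Θ v ⌝ ⌜ u ⌝) ≡ substP (consK F (consV u Θ)) (capp zero (wkKT (app ⌜ wkV v ⌝ (var zero))))
plugP-app-consK-consV F Θ v u =
  trans (cong (λ f → plugP F (app f ⌜ u ⌝)) (sym operator))
    (plugP-substT-consK F (consV u Θ) (app ⌜ wkV v ⌝ (var zero)))
  where
  operator : substT (consV u Θ) ⌜ wkV v ⌝ ≡ ⌜ substV Θ v ⌝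
  operator = trans (substT-⌜⌝ (consV u Θ) (wkV v)) (cong ⌜_⌝ (substV-renV (consV u Θ) idF suc v))

renT≡⌜⌝ : ∀ (κ' : Fin m → Fin m') (ρ : Fin n → Fin n') (t : Term m n) {v : Val m' n'} →
  renT κ' ρ t ≡ ⌜ v ⌝ → ∃[ v₀ ] (t ≡ ⌜ v₀ ⌝ × renV κ' ρ v₀ ≡ v)
renT≡⌜⌝ κ' ρ (var x) e = vvar x , refl , ⌜⌝-injective e
renT≡⌜⌝ κ' ρ (lam t) e = vlam t , refl , ⌜⌝-injective e
renT≡⌜⌝ κ' ρ callcc e = vcc , refl , ⌜⌝-injective e
renT≡⌜⌝ κ' ρ (app t s) {v} e = ⊥-elim (subst IsValue (sym e) (⌜⌝-isValue v))
renT≡⌜⌝ κ' ρ (abort p) {v} e = ⊥-elim (subst IsValue (sym e) (⌜⌝-isValue v))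

plugP-compP-⟶* : ∀ (F : PCtx m n) E {t t' : Term m n} →
  plugP (compP F E) t ⟶* plugP (compP F E) t' → plugP F (plugE E t) ⟶* plugP F (plugE E t')
plugP-compP-⟶* F E = subst₂ _⟶*_ (plugP-compP F E _) (plugP-compP F E _)

plugP-appL≡appR : ∀ (F : PCtx m n) t v → plugP (compP F (appL hole t)) ⌜ v ⌝ ≡ plugP (compP F (appR v hole)) t
plugP-appL≡appR F t v = trans (plugP-compP F (appL hole t) ⌜ v ⌝) (sym (plugP-compP F (appR v hole) t))

Step∼ : Prog 0 0 → Prog 0 0 → Set₁
Step∼ P Q = ∃[ P' ] ∃[ Q' ] (P ⟶ P' × Q ⟶* Q' × P' ∼P Q')

data Outcome (P Q : Prog 0 0) : Set₁ where
  halts : ∃[ v ] (P ≡ term ⌜ v ⌝) → ∃[ w ] (Q ⟶* term ⌜ w ⌝) → Outcome P Q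
  steps : Step∼ P Q → Outcome P Q

Step∼-⟵ : {P P₁ Q Q₁ : Prog 0 0} → P ≡ P₁ → Q ⟶* Q₁ → Step∼ P₁ Q₁ → Step∼ P Q
Step∼-⟵ refl red (P' , Q' , st , red' , P'∼Q') = P' , Q' , st , red ◅◅ red' , P'∼Q'

Outcome-⟵ : {P P₁ Q Q₁ : Prog 0 0} → P ≡ P₁ → Q ⟶* Q₁ → Outcome P₁ Q₁ → Outcome P Q
Outcome-⟵ refl red (halts v (w , red')) = halts v (w , red ◅◅ red')
Outcome-⟵ eq red (steps s) = steps (Step∼-⟵ eq red s)

Step∼-base : {p₀ q₀ p₀' : Prog m0 n0} {Θ Θ' : Sub m0 n0 0 0} → p₀ ≈ q₀ → Θ ∼S Θ' → p₀ ⟶ p₀' →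
  Step∼ (substP Θ p₀) (substP Θ' q₀)
Step∼-base {Θ = Θ} {Θ'} A Θ∼ st =
  let (_ , red , A') = ≈-red A st in _ , _ , substP-⟶ Θ st , substP-⟶* Θ' red , p-base A' Θ∼

mutual
  ∼-apply : {f f' u u' : Val 0 0} {F F' : PCtx 0 0} → f ∼V f' → u ∼V u' → F ∼F F' →
    Step∼ (plugP F (app ⌜ f ⌝ ⌜ u ⌝)) (plugP F' (app ⌜ f' ⌝ ⌜ u' ⌝))
  ∼-apply (v-var ())
  ∼-apply {u = u} {u'} {F} {F'} (v-lam {b} {b'} b∼) u∼ F∼ =
    _ , _ , β F b u , β F' b' u' ◅ ε , p-plug F∼ (∼T-[] b∼ u∼)
  ∼-apply {u = u} {u'} {F} {F'} v-cc u∼ F∼ =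
    _ , _ , ccRed F u , ccRed F' u' ◅ ε ,
    p-plug F∼ (t-app (t-val u∼) (t-val (v-lam (t-abort (p-plug (∼F-ren suc F∼) (t-val (v-var zero)))))))
  ∼-apply (v-base A Θ∼) u∼ F∼ = ∼-apply-base A Θ∼ u∼ F∼

  -- (_≈_ ^v) relates the η-expansions k (v x); instantiate k := F and x := u.
  ∼-apply-base : {v₀ w₀ : Val m0 n0} {Θ Θ' : Sub m0 n0 0 0} {u u' : Val 0 0} {F F' : PCtx 0 0} →
    (_≈_ ^v) v₀ w₀ → Θ ∼S Θ' → u ∼V u' → F ∼F F' →
    Step∼ (plugP F (app ⌜ substV Θ v₀ ⌝ ⌜ u ⌝)) (plugP F' (app ⌜ substV Θ' w₀ ⌝ ⌜ u' ⌝))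
  ∼-apply-base {v₀ = v₀} {w₀} {Θ} {Θ'} {u} {u'} {F} {F'} A Θ∼@(mk∼S _ σ∼) u∼ F∼ =
    Step∼-⟵ (plugP-app-consK-consV F Θ v₀ u) (≡⇒⟶* (plugP-app-consK-consV F' Θ' w₀ u')) (η-step v₀ A)
    where
    Θ₊∼ : consK F (consV u Θ) ∼S consK F' (consV u' Θ')
    Θ₊∼ = ∼S-consK F∼ (∼S-consV u∼ Θ∼)
    η-step : (v₀ : Val _ _) → (_≈_ ^v) v₀ w₀ →
      Step∼ (substP (consK F (consV u Θ)) (capp zero (wkKT (app ⌜ wkV v₀ ⌝ (var zero)))))
            (substP (consK F' (consV u' Θ')) (capp zero (wkKT (app ⌜ wkV w₀ ⌝ (var zero)))))
    η-step (vlam b) A = Step∼-base A Θ₊∼ (β (kctx zero hole) _ (vvar zero))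
    η-step vcc A = Step∼-base A Θ₊∼ (ccRed (kctx zero hole) (vvar zero))
    η-step (vvar z) A = Step∼-stuck (kctx zero hole) (suc z) (vvar zero) A Θ₊∼ (σ∼ z) refl

  Step∼-stuck : {p₀ q₀ : Prog m0 n0} {Θ Θ' : Sub m0 n0 0 0} (G : PCtx m0 n0) (x : Fin n0) (v : Val m0 n0) →
    p₀ ≈ q₀ → Θ ∼S Θ' → σ Θ x ∼V σ Θ' x → p₀ ≡ plugP G (app (var x) ⌜ v ⌝) → Step∼ (substP Θ p₀) (substP Θ' q₀)
  Step∼-stuck {Θ = Θ} {Θ'} G x v A Θ∼ x∼ eq =
    let (G' , w , red , G≈G' , v≈w) = ≈-stuck A eq in
    Step∼-⟵ (trans (cong (substP Θ) eq) (substP-plugP-app Θ G (var x) v))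
      (substP-⟶* Θ' red ◅◅ ≡⇒⟶* (substP-plugP-app Θ' G' (var x) w))
      (∼-apply x∼ (v-base v≈w Θ∼) (f-base G≈G' Θ∼))

data Focus (t t' : Term 0 0) : Set₁ where
  value : (v : Val 0 0) → t ≡ ⌜ v ⌝ →
          (∀ {F F'} → F ∼F F' → ∃[ w ] (plugP F' t' ⟶* plugP F' ⌜ w ⌝ × v ∼V w)) → Focus t t'
  step  : (∀ {F F'} → F ∼F F' → Step∼ (plugP F t) (plugP F' t')) → Focus t t'

focus-app : {t₁ t₁' t₂ t₂' : Term 0 0} → Focus t₁ t₁' → t₂ ∼T t₂' → Focus t₂ t₂' → Focus (app t₁ t₂) (app t₁' t₂')
focus-app {t₂ = t₂} {t₂'} (step act₁) t₂∼ _ = step λ {F} {F'} F∼ →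
  Step∼-⟵ (sym (plugP-compP F (appL hole t₂) _)) (≡⇒⟶* (sym (plugP-compP F' (appL hole t₂') _)))
    (act₁ (f-appL F∼ t₂∼))
focus-app {t₂ = t₂} {t₂'} (value v₁ refl eval₁) t₂∼ (step act₂) = step λ {F} {F'} F∼ →
  let (w₁ , red₁ , v₁∼w₁) = eval₁ (f-appL F∼ t₂∼) in
  Step∼-⟵ (sym (plugP-compP F (appR v₁ hole) t₂))
    (plugP-compP-⟶* F' (appL hole t₂') red₁ ◅◅ ≡⇒⟶* (sym (plugP-compP F' (appR w₁ hole) t₂')))
    (act₂ (f-appR F∼ v₁∼w₁))
focus-app {t₂' = t₂'} (value v₁ refl eval₁) t₂∼ (value v₂ refl eval₂) = step λ {F} {F'} F∼ →
  let (w₁ , red₁ , v₁∼w₁) = eval₁ (f-appL F∼ t₂∼)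
      (w₂ , red₂ , v₂∼w₂) = eval₂ (f-appR F∼ v₁∼w₁)
  in Step∼-⟵ refl (plugP-compP-⟶* F' (appL hole t₂') red₁ ◅◅ plugP-compP-⟶* F' (appR w₁ hole) red₂)
       (∼-apply v₁∼w₁ v₂∼w₂ F∼)

focus-base-kvalue : {t₀ s₀ : Term m0 n0} {Θ Θ' : Sub m0 n0 0 0} {k : Fin (suc m0)} {v : Val (suc m0) n0} →
  (_≈_ ^t) t₀ s₀ → Θ ∼S Θ' → capp zero (wkKT t₀) ≡ capp k ⌜ v ⌝ → Focus (substT Θ t₀) (substT Θ' s₀)
focus-base-kvalue {t₀ = t₀} {s₀} {Θ} {Θ'} A Θ∼ eq with capp-injective eq
... | refl , wk≡v with renT≡⌜⌝ suc idF t₀ wk≡v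
... | v₀ , refl , refl = value (substV Θ v₀) (substT-⌜⌝ Θ v₀) eval
  where
  eval : ∀ {F F'} → F ∼F F' → ∃[ w ] (plugP F' (substT Θ' s₀) ⟶* plugP F' ⌜ w ⌝ × substV Θ v₀ ∼V w)
  eval {F} {F'} F∼ =
    let (w , red , v≈w) = ≈-kvalue A eq in
    substV (consK F' Θ') w ,
    ≡⇒⟶* (plugP-substT-consK F' Θ' s₀) ◅◅ substP-⟶* (consK F' Θ') red ◅◅
      ≡⇒⟶* (cong (plugP F') (substT-⌜⌝ (consK F' Θ') w)) ,
    subst (_∼V substV (consK F' Θ') w) (substV-renV (consK F Θ) suc idF v₀) (v-base v≈w (∼S-consK F∼ Θ∼))

focus-base : {t₀ s₀ : Term m0 n0} {Θ Θ' : Sub m0 n0 0 0} → (_≈_ ^t) t₀ s₀ → Θ ∼S Θ' →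
  Focus (substT Θ t₀) (substT Θ' s₀)
focus-base {t₀ = t₀} {s₀} {Θ} {Θ'} A Θ∼@(mk∼S _ σ∼) with progView (capp zero (wkKT t₀))
... | step _ st = step λ {F} {F'} F∼ →
  Step∼-⟵ (plugP-substT-consK F Θ t₀) (≡⇒⟶* (plugP-substT-consK F' Θ' s₀)) (Step∼-base A (∼S-consK F∼ Θ∼) st)
... | stuck G x v eq = step λ {F} {F'} F∼ →
  Step∼-⟵ (plugP-substT-consK F Θ t₀) (≡⇒⟶* (plugP-substT-consK F' Θ' s₀))
    (Step∼-stuck G x v A (∼S-consK F∼ Θ∼) (σ∼ x) eq)
... | kvalue k v eq = focus-base-kvalue A Θ∼ eq

focus : {t t' : Term 0 0} → t ∼T t' → Focus t t'
focus (t-val v∼w) = value _ refl (λ _ → _ , ε , v∼w)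
focus (t-app t₁∼ t₂∼) = focus-app (focus t₁∼) t₂∼ (focus t₂∼)
focus (t-abort {p} {p'} p∼) = step (λ {F} {F'} _ → p , p' , abRed F p , abRed F' p' ◅ ε , p∼)
focus (t-base A Θ∼) = focus-base A Θ∼

outcome-base : {p₀ q₀ : Prog m0 n0} {Θ Θ' : Sub m0 n0 0 0} → p₀ ≈ q₀ → Θ ∼S Θ' →
  (∀ k {v w} → v ∼V w → Outcome (plugP (κ Θ k) ⌜ v ⌝) (plugP (κ Θ' k) ⌜ w ⌝)) → Outcome (substP Θ p₀) (substP Θ' q₀)
outcome-base {p₀ = p₀} {Θ = Θ} {Θ'} A Θ∼@(mk∼S _ σ∼) return with progView p₀
... | step _ st = steps (Step∼-base A Θ∼ st)
... | stuck G x v eq = steps (Step∼-stuck G x v A Θ∼ (σ∼ x) eq)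
... | value v refl =
  let (w , red) = ≈-value A refl in
  halts (substV Θ v , cong term (substT-⌜⌝ Θ v)) (substV Θ' w , substP-⟶* Θ' red ◅◅ ≡⇒⟶* (cong term (substT-⌜⌝ Θ' w)))
... | kvalue k v refl =
  let (w , red , v≈w) = ≈-kvalue A refl in
  Outcome-⟵ (cong (plugP (κ Θ k)) (substT-⌜⌝ Θ v))
    (substP-⟶* Θ' red ◅◅ ≡⇒⟶* (cong (plugP (κ Θ' k)) (substT-⌜⌝ Θ' w)))
    (return k (v-base v≈w Θ∼))

∼F-return : {F F' : PCtx 0 0} {v w : Val 0 0} → F ∼F F' → v ∼V w → Outcome (plugP F ⌜ v ⌝) (plugP F' ⌜ w ⌝)
∼F-return f-hole v∼w = halts (_ , refl) (_ , ε)
∼F-return {v = v} {w} (f-appL {F} {F'} {t} {t'} F∼ t∼) v∼w with focus t∼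
... | step act = steps (Step∼-⟵ (plugP-appL≡appR F t v) (≡⇒⟶* (plugP-appL≡appR F' t' w)) (act (f-appR F∼ v∼w)))
... | value v₂ refl eval =
  let (w₂ , red , v₂∼w₂) = eval (f-appR F∼ v∼w) in
  steps (Step∼-⟵ (plugP-compP F (appL hole ⌜ v₂ ⌝) ⌜ v ⌝)
    (≡⇒⟶* (plugP-compP F' (appL hole t') ⌜ w ⌝) ◅◅ plugP-compP-⟶* F' (appR w hole) red)
    (∼-apply v∼w v₂∼w₂ F∼))
∼F-return (f-appR {F} {F'} {f} {f'} F∼ f∼) v∼w =
  steps (Step∼-⟵ (plugP-compP F (appR f hole) _) (≡⇒⟶* (plugP-compP F' (appR f' hole) _)) (∼-apply f∼ v∼w F∼))
∼F-return (f-base {F₀ = F₀} {G₀} {Θ} {Θ'} A Θ∼@(mk∼S κ∼ _)) v∼w =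
  Outcome-⟵ (plugP-substF-consV Θ F₀ _) (≡⇒⟶* (plugP-substF-consV Θ' G₀ _))
    (outcome-base A (∼S-consV v∼w Θ∼) (λ k → ∼F-return (κ∼ k)))

∼P-outcome : {P Q : Prog 0 0} → P ∼P Q → Outcome P Q
∼P-outcome (p-plug F∼ t∼) with focus t∼
... | step act = steps (act F∼)
... | value v refl eval = let (w , red , v∼w) = eval F∼ in Outcome-⟵ refl red (∼F-return F∼ v∼w)
∼P-outcome (p-base A Θ∼@(mk∼S κ∼ _)) = outcome-base A Θ∼ (λ k → ∼F-return (κ∼ k))

∼P-terminates : {P Q R : Prog 0 0} → P ∼P Q → P ⟶* R → Irreducible R → Terminates Q
∼P-terminates P∼Q ε irr with ∼P-outcome P∼Q
... | halts _ (w , red) = term ⌜ w ⌝ , red , value-irreducible w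
... | steps (P' , _ , st , _) = ⊥-elim (irr (P' , st))
∼P-terminates P∼Q (st ◅ rest) irr with ∼P-outcome P∼Q
... | halts (v , refl) _ = ⊥-elim (value-irreducible v (_ , st))
... | steps (_ , _ , st' , red , P'∼Q') with ⟶-deterministic st st' refl
... | refl = let (q , red' , irr') = ∼P-terminates P'∼Q' rest irr in q , red ◅◅ red' , irr'

∼T-refl : (t : Term 0 n) → t ∼T t
∼T-refl (var x) = t-val (v-var x)
∼T-refl (lam t) = t-val (v-lam (∼T-refl t))
∼T-refl (app t s) = t-app (∼T-refl t) (∼T-refl s)
∼T-refl callcc = t-val v-cc
∼T-refl (abort (term t)) = t-abort (p-plug f-hole (∼T-refl t))

∼T-plugC : (C : Ctx n h) {t s : Term 0 h} → t ∼T s → plugC C t ∼T plugC C s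
∼T-plugC ● t∼s = t∼s
∼T-plugC (lamC C) t∼s = t-val (v-lam (∼T-plugC C t∼s))
∼T-plugC (appLC C u) t∼s = t-app (∼T-plugC C t∼s) (∼T-refl u)
∼T-plugC (appRC u C) t∼s = t-app (∼T-refl u) (∼T-plugC C t∼s)
∼T-plugC (abortC C) t∼s = t-abort (p-plug f-hole (∼T-plugC C t∼s))

≈^t⇒∼T : {t s : Term 0 n} → (_≈_ ^t) t s → t ∼T s
≈^t⇒∼T {t = t} {s} A = subst₂ _∼T_ (substT-idS t) (substT-idS s) (t-base A ∼S-idS)

≈^t⇒terminates : {t s : Term 0 n} → (_≈_ ^t) t s → (C : Ctx 0 n) →
  Terminates (term (plugC C t)) → Terminates (term (plugC C s))
≈^t⇒terminates A C (_ , red , irr) = ∼P-terminates (p-plug f-hole (∼T-plugC C (≈^t⇒∼T A))) red irr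

theorem5p9 : {n : ℕ} (t s : Term 0 n) → (_≈_ ^t) t s →
    (C : Ctx 0 n) →
    ((Terminates (term (plugC C t)) → Terminates (term (plugC C s)))
     × (Terminates (term (plugC C s)) → Terminates (term (plugC C t))))
theorem5p9 t s A C = ≈^t⇒terminates A C , ≈^t⇒terminates (≈-sym A) C
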